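{- Let $\mathcal{B}_4$ be the set of partitions $\lambda=(\lambda_1>\lambda_2>\cdots>\lambda_\ell)$ into positive parts such that for each $1\le i<\ell$: $\lambda_i-\lambda_{i+1}=2$ if $\lambda_i,\lambda_{i+1}$ are both odd; $\lambda_i-\lambda_{i+1}=4$ if they are both even; $\lambda_i-\lambda_{i+1}=3$ if they have different parity; and the smallest part $\lambda_\ell$ equals $1$ or $2$. For integers $n,h$, let $$B_4(n,h)=B_4(n,h;x,y,q)=\sum x^{o(\lambda)}y^{e(\lambda)}q^{|\lambda|},$$ the sum over all $\lambda\in\mathcal{B}_4$ with exactly $n$ parts and largest part $h$, where $o(\lambda)$ and $e(\lambda)$ denote the numbers of odd and even parts of $\lambda$. Then for all integers $n\ge1$ and $h\ge1$, $$B_4(n,2n+2h-1)=x^{n-h}y^{h}q^{n^2+h^2+2h}{n-1\brack h}_{q^2},\qquad B_4(n,2n+2h)=x^{n-h-1}y^{h+1}q^{n^2+h^2+2h+1}{n-1\brack h}_{q^2}.$$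
   Context: $|\lambda|$ is the sum of the parts. The Gaussian coefficient is ${a+b\brack b}_q=\frac{(q;q)_{a+b}}{(q;q)_a(q;q)_b}$ if $a,b\ge0$ and $0$ otherwise, where $(a;q)_n=\prod_{i=0}^{n-1}(1-aq^i)$. -}

module Defs where

open import Data.Bool using (Bool; true; false; _∧_; _∨_; not; if_then_else_)
open import Data.Nat using (ℕ; zero; suc; _+_; _*_; _∸_; _≡ᵇ_; _≤ᵇ_)
open import Data.Integer as ℤ using (ℤ; +_; -_)
open import Data.List using (List; []; _∷_; map; concatMap; length; upTo)
open import Data.Nat.ListAction using (sum)

-- A partition λ = (λ₁ > λ₂ > ⋯ > λ_ℓ) is represented by the list
-- λ₁ ∷ λ₂ ∷ ⋯ ∷ λ_ℓ ∷ [] (largest part first).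

isOdd : ℕ → Bool
isOdd zero          = false
isOdd (suc zero)    = true
isOdd (suc (suc n)) = isOdd n

isEven : ℕ → Bool
isEven n = not (isOdd n)

gapOK : ℕ → ℕ → Bool
gapOK a b =
  if isOdd a ∧ isOdd b then a ≡ᵇ b + 2
  else if isEven a ∧ isEven b then a ≡ᵇ b + 4
  else a ≡ᵇ b + 3

gapsOK : List ℕ → Bool
gapsOK []            = true
gapsOK (a ∷ [])      = true
gapsOK (a ∷ b ∷ bs)  = gapOK a b ∧ gapsOK (b ∷ bs)

allPos : List ℕ → Bool
allPos []       = true
allPos (a ∷ as) = (1 ≤ᵇ a) ∧ allPos as

lastOK : List ℕ → Bool
lastOK []           = false
lastOK (a ∷ [])     = (a ≡ᵇ 1) ∨ (a ≡ᵇ 2)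
lastOK (a ∷ b ∷ bs) = lastOK (b ∷ bs)

-- membership in 𝓑₄ (strict decrease is implied by the gap conditions)
inB4 : List ℕ → Bool
inB4 λs = allPos λs ∧ gapsOK λs ∧ lastOK λs

largestIs : ℕ → List ℕ → Bool
largestIs h []      = false
largestIs h (a ∷ _) = a ≡ᵇ h

o : List ℕ → ℕ
o []       = 0
o (a ∷ as) = (if isOdd a then 1 else 0) + o as

e : List ℕ → ℕ
e []       = 0
e (a ∷ as) = (if isOdd a then 0 else 1) + e as

listsOf : ℕ → List ℕ → List (List ℕ)
listsOf zero    xs = [] ∷ []
listsOf (suc n) xs = concatMap (λ x → map (x ∷_) (listsOf n xs)) xs

-- candidates: all lists of length n with entries in {0,…,h}.  Every
-- partition with n parts and largest part h occurs exactly once here.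
candidates : ℕ → ℕ → List (List ℕ)
candidates n h = listsOf n (upTo (suc h))

-- univariate series in q : coefficient of q^m
Ser : Set
Ser = ℕ → ℤ

Σ≤ : ℕ → (ℕ → ℤ) → ℤ
Σ≤ zero    f = f 0
Σ≤ (suc m) f = Σ≤ m f ℤ.+ f (suc m)

zeroS : Ser
zeroS _ = + 0

oneS : Ser
oneS m = if m ≡ᵇ 0 then + 1 else + 0

monoS : ℕ → Ser
monoS c m = if m ≡ᵇ c then + 1 else + 0

_⊝_ : Ser → Ser → Ser
(f ⊝ g) m = f m ℤ.- g m

_⊛_ : Ser → Ser → Ser
(f ⊛ g) m = Σ≤ m (λ k → f k ℤ.* g (m ∸ k))

infixl 7 _⊛_

-- Multiplicative inverse of a series f with constant term f 0 = 1.
-- invUpTo f m j is the j-th coefficient of f⁻¹ for j ≤ m, via the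
-- recursion c₀ = 1, c_{m+1} = - Σ_{k=1}^{m+1} f k · c_{m+1-k}.
invUpTo : Ser → ℕ → (ℕ → ℤ)
invUpTo f zero    = λ _ → + 1
invUpTo f (suc m) = λ j →
  if j ≤ᵇ m then invUpTo f m j
  else ℤ.- Σ≤ m (λ k → f (suc k) ℤ.* invUpTo f m (m ∸ k))

inv : Ser → Ser
inv f m = invUpTo f m m

qPoch : ℕ → ℕ → ℕ → Ser
qPoch a d zero    = oneS
qPoch a d (suc n) = qPoch a d n ⊛ (oneS ⊝ monoS (a + d * n))

-- Gaussian coefficient in base Q = q^d, for a, b ≥ 0:
--   [a+b, b]_Q = (Q;Q)_{a+b} / ((Q;Q)_a (Q;Q)_b)
-- (division in the power series ring; (Q;Q)_k has constant term 1)
gaussAB : ℕ → ℕ → ℕ → Ser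
gaussAB d a b = qPoch d d (a + b) ⊛ inv (qPoch d d a) ⊛ inv (qPoch d d b)

gaussian : ℕ → ℕ → ℕ → Ser
gaussian d top bot = if bot ≤ᵇ top then gaussAB d (top ∸ bot) bot else zeroS

-- Trivariate series in x, y, q : coefficient of x^i y^j q^m

Ser3 : Set
Ser3 = ℕ → ℕ → ℕ → ℤ

zero3 : Ser3
zero3 _ _ _ = + 0

_⊕₃_ : Ser3 → Ser3 → Ser3
(F ⊕₃ G) i j m = F i j m ℤ.+ G i j m

mono3 : ℕ → ℕ → ℕ → Ser3
mono3 a b c i j m = if (i ≡ᵇ a) ∧ (j ≡ᵇ b) ∧ (m ≡ᵇ c) then + 1 else + 0

_⊛₃_ : Ser3 → Ser3 → Ser3
(F ⊛₃ G) i j m =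
  Σ≤ i (λ i′ → Σ≤ j (λ j′ → Σ≤ m (λ m′ →
    F i′ j′ m′ ℤ.* G (i ∸ i′) (j ∸ j′) (m ∸ m′))))

liftQ : Ser → Ser3
liftQ f i j m = if (i ≡ᵇ 0) ∧ (j ≡ᵇ 0) then f m else + 0

sumOver : List (List ℕ) → (List ℕ → Ser3) → Ser3
sumOver []       F = zero3
sumOver (l ∷ ls) F = F l ⊕₃ sumOver ls F

B4 : ℕ → ℕ → Ser3
B4 n h = sumOver (candidates n h) (λ λs →
  if inB4 λs ∧ largestIs h λs ∧ (length λs ≡ᵇ n)
  then mono3 (o λs) (e λs) (sum λs)
  else zero3)

module Submission where

-- Deleting the largest part H of a 𝓑₄-partition with n ≥ 2 parts leaves one with n − 1 parts
-- whose largest part is H − 3 (opposite parity) or, of the same parity, H − 2 if H is odd and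
-- H − 4 if H is even.  Hence
--   B₄(n, H) = x^[H odd] y^[H even] q^H (B₄(n−1, H − 2 or H − 4) + B₄(n−1, H − 3)).
-- For H = 2n+2h−1 and for H = 2n+2h the two terms are the claimed closed forms for (n−1, h)
-- with odd largest part and for (n−1, h−1) with even largest part.  After factoring out the
-- common monomial their sum is Pascal's rule
--   [n−1, h]_{q²} = q^{2h} [n−2, h]_{q²} + [n−2, h−1]_{q²},
-- so both closed forms follow by a joint induction on n.  The Gaussian coefficient, defined
-- through inverses of (q²;q²)_k, agrees with the Pascal-recursive one because the latter
-- satisfies [N, k]_{q²} (q²;q²)_k (q²;q²)_{N−k} = (q²;q²)_N.

open import Defs
open import Algebra.Bundles using (CommutativeMonoid)
import Algebra.Construct.Pointwise as Pointwise
import Algebra.Properties.CommutativeSemigroup as CommutativeSemigroupProperties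
open import Data.Bool using (Bool; true; false; not; _∧_; if_then_else_)
import Data.Bool.Properties as Boolₚ
open import Data.Integer using (ℤ; +_; -_)
  renaming (_+_ to _+ᶻ_; _*_ to _*ᶻ_; _-_ to _-ᶻ_)
import Data.Integer.Properties as ℤₚ
import Data.Integer.Tactic.RingSolver as ℤ-Solver
open import Data.List using (List; []; _∷_; _++_; map; concatMap; length; applyUpTo; upTo)
open import Data.Nat as ℕ using (ℕ; zero; suc; _+_; _*_; _∸_; _≤_; _<_; z≤n; s≤s; _≡ᵇ_; _≤ᵇ_)
import Data.Nat.Properties as ℕₚ
import Data.Nat.Tactic.RingSolver as ℕ-Solver
open import Data.Nat.ListAction using (sum)
open import Data.Product using (_×_; _,_)
open import Data.Sum using (_⊎_; inj₁; inj₂)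
open import Function using (_∘_; mk⇔)
open import Level using (0ℓ)
open import Relation.Binary.Bundles using (Setoid)
open import Relation.Binary.PropositionalEquality
import Relation.Binary.Reasoning.Setoid as SetoidReasoning
open import Relation.Nullary using (¬_; yes; no)
open import Relation.Nullary.Decidable using (dec-true; dec-false; does-⇔)

≡ᵇ-refl : ∀ n → (n ≡ᵇ n) ≡ true
≡ᵇ-refl n = dec-true (n ℕ.≟ n) refl

≡ᵇ-false : ∀ {m n} → m ≢ n → (m ≡ᵇ n) ≡ false
≡ᵇ-false {m} {n} = dec-false (m ℕ.≟ n)

≤ᵇ-true : ∀ {m n} → m ≤ n → (m ≤ᵇ n) ≡ true
≤ᵇ-true {m} {n} = dec-true (m ℕ.≤? n)

≤ᵇ-false : ∀ {m n} → ¬ m ≤ n → (m ≤ᵇ n) ≡ false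
≤ᵇ-false {m} {n} = dec-false (m ℕ.≤? n)

-- Finite sums

Σ≤-cong-≤ : ∀ m {f g : ℕ → ℤ} → (∀ k → k ≤ m → f k ≡ g k) → Σ≤ m f ≡ Σ≤ m g
Σ≤-cong-≤ zero    f≡g = f≡g 0 z≤n
Σ≤-cong-≤ (suc m) f≡g =
  cong₂ _+ᶻ_ (Σ≤-cong-≤ m (λ k k≤m → f≡g k (ℕₚ.m≤n⇒m≤1+n k≤m))) (f≡g (suc m) ℕₚ.≤-refl)

Σ≤-cong : ∀ m {f g : ℕ → ℤ} → f ≗ g → Σ≤ m f ≡ Σ≤ m g
Σ≤-cong m f≗g = Σ≤-cong-≤ m (λ k _ → f≗g k)

Σ≤-+ : ∀ m (f g : ℕ → ℤ) → Σ≤ m (λ k → f k +ᶻ g k) ≡ Σ≤ m f +ᶻ Σ≤ m g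
Σ≤-+ zero    f g = refl
Σ≤-+ (suc m) f g = trans (cong (_+ᶻ (f (suc m) +ᶻ g (suc m))) (Σ≤-+ m f g))
                         (interchange (Σ≤ m f) (Σ≤ m g) (f (suc m)) (g (suc m)))
  where
  interchange : ∀ a b c d → a +ᶻ b +ᶻ (c +ᶻ d) ≡ a +ᶻ c +ᶻ (b +ᶻ d)
  interchange = ℤ-Solver.solve-∀

Σ≤-*ˡ : ∀ m c (f : ℕ → ℤ) → Σ≤ m (λ k → c *ᶻ f k) ≡ c *ᶻ Σ≤ m f
Σ≤-*ˡ zero    c f = refl
Σ≤-*ˡ (suc m) c f = trans (cong (_+ᶻ c *ᶻ f (suc m)) (Σ≤-*ˡ m c f))
                          (sym (ℤₚ.*-distribˡ-+ c (Σ≤ m f) (f (suc m))))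

Σ≤-*ʳ : ∀ m c (f : ℕ → ℤ) → Σ≤ m (λ k → f k *ᶻ c) ≡ Σ≤ m f *ᶻ c
Σ≤-*ʳ zero    c f = refl
Σ≤-*ʳ (suc m) c f = trans (cong (_+ᶻ f (suc m) *ᶻ c) (Σ≤-*ʳ m c f))
                          (sym (ℤₚ.*-distribʳ-+ c (Σ≤ m f) (f (suc m))))

Σ≤-neg : ∀ m (f : ℕ → ℤ) → Σ≤ m (λ k → - f k) ≡ - Σ≤ m f
Σ≤-neg zero    f = refl
Σ≤-neg (suc m) f = trans (cong (_+ᶻ - f (suc m)) (Σ≤-neg m f))
                         (sym (ℤₚ.neg-distrib-+ (Σ≤ m f) (f (suc m))))

Σ≤-vanish : ∀ m {f : ℕ → ℤ} → (∀ k → k ≤ m → f k ≡ + 0) → Σ≤ m f ≡ + 0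
Σ≤-vanish zero    f≡0 = f≡0 0 z≤n
Σ≤-vanish (suc m) f≡0 =
  cong₂ _+ᶻ_ (Σ≤-vanish m (λ k k≤m → f≡0 k (ℕₚ.m≤n⇒m≤1+n k≤m))) (f≡0 (suc m) ℕₚ.≤-refl)

Σ≤-single : ∀ m c {f : ℕ → ℤ} → (∀ k → k ≢ c → f k ≡ + 0) → c ≤ m → Σ≤ m f ≡ f c
Σ≤-single zero    .zero f≡0 z≤n = refl
Σ≤-single (suc m) c {f} f≡0 c≤1+m with ℕₚ.m≤n⇒m<n∨m≡n c≤1+m
... | inj₁ (s≤s c≤m) =
  trans (cong₂ _+ᶻ_ (Σ≤-single m c f≡0 c≤m) (f≡0 (suc m) (λ { refl → ℕₚ.1+n≰n c≤m })))
        (ℤₚ.+-identityʳ _)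
... | inj₂ refl =
  trans (cong (_+ᶻ f (suc m)) (Σ≤-vanish m (λ k k≤m → f≡0 k (λ { refl → ℕₚ.1+n≰n k≤m }))))
        (ℤₚ.+-identityˡ (f (suc m)))

Σ≤-suc : ∀ m (f : ℕ → ℤ) → Σ≤ (suc m) f ≡ f 0 +ᶻ Σ≤ m (f ∘ suc)
Σ≤-suc zero    f = refl
Σ≤-suc (suc m) f = trans (cong (_+ᶻ f (2 + m)) (Σ≤-suc m f)) (ℤₚ.+-assoc (f 0) _ _)

Σ≤-reverse : ∀ m (f : ℕ → ℤ) → Σ≤ m f ≡ Σ≤ m (λ k → f (m ∸ k))
Σ≤-reverse zero    f = refl
Σ≤-reverse (suc m) f = begin
  Σ≤ m f +ᶻ f (suc m)                      ≡⟨ ℤₚ.+-comm (Σ≤ m f) _ ⟩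
  f (suc m) +ᶻ Σ≤ m f                      ≡⟨ cong (f (suc m) +ᶻ_) (Σ≤-reverse m f) ⟩
  f (suc m) +ᶻ Σ≤ m (λ k → f (m ∸ k))      ≡⟨ Σ≤-suc m (λ k → f (suc m ∸ k)) ⟨
  Σ≤ (suc m) (λ k → f (suc m ∸ k))         ∎
  where open ≡-Reasoning

Σ≤-triangle : ∀ m (F : ℕ → ℕ → ℤ) →
  Σ≤ m (λ k → Σ≤ k (λ i → F i k)) ≡ Σ≤ m (λ i → Σ≤ (m ∸ i) (λ j → F i (i + j)))
Σ≤-triangle zero    F = refl
Σ≤-triangle (suc m) F = begin
  Σ≤ m (λ k → Σ≤ k (λ i → F i k)) +ᶻ (Σ≤ m (λ i → F i (suc m)) +ᶻ F (suc m) (suc m))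
    ≡⟨ cong (_+ᶻ (Σ≤ m (λ i → F i (suc m)) +ᶻ F (suc m) (suc m))) (Σ≤-triangle m F) ⟩
  rows m +ᶻ (Σ≤ m (λ i → F i (suc m)) +ᶻ F (suc m) (suc m))
    ≡⟨ ℤₚ.+-assoc (rows m) _ _ ⟨
  rows m +ᶻ Σ≤ m (λ i → F i (suc m)) +ᶻ F (suc m) (suc m)
    ≡⟨ cong₂ _+ᶻ_ (sym (Σ≤-+ m _ _)) (cong (F (suc m)) (sym (ℕₚ.+-identityʳ (suc m)))) ⟩
  Σ≤ m (λ i → row m i +ᶻ F i (suc m)) +ᶻ F (suc m) (suc m + 0)
    ≡⟨ cong₂ _+ᶻ_ (Σ≤-cong-≤ m extend-row) (cong (λ t → Σ≤ t (λ j → F (suc m) (suc m + j))) (sym (ℕₚ.n∸n≡0 m))) ⟩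
  Σ≤ m (row (suc m)) +ᶻ row (suc m) (suc m) ∎
  where
  open ≡-Reasoning
  row : ℕ → ℕ → ℤ
  row m i = Σ≤ (m ∸ i) (λ j → F i (i + j))
  rows : ℕ → ℤ
  rows m = Σ≤ m (row m)
  extend-row : ∀ i → i ≤ m → row m i +ᶻ F i (suc m) ≡ row (suc m) i
  extend-row i i≤m rewrite ℕₚ.+-∸-assoc 1 i≤m =
    cong (λ t → row m i +ᶻ F i t) (sym (trans (ℕₚ.+-suc i (m ∸ i)) (cong suc (ℕₚ.m+[n∸m]≡n i≤m))))

-- Power series in q

module ≗-Reasoning = SetoidReasoning (ℕ →-setoid ℤ)
open Setoid (ℕ →-setoid ℤ) using () renaming (sym to ≗-sym)

infixl 6 _⊕_
_⊕_ : Ser → Ser → Ser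
(f ⊕ g) m = f m +ᶻ g m

⊕-cong : ∀ {f f′ g g′} → f ≗ f′ → g ≗ g′ → f ⊕ g ≗ f′ ⊕ g′
⊕-cong f≗f′ g≗g′ m = cong₂ _+ᶻ_ (f≗f′ m) (g≗g′ m)

⊕-congˡ : ∀ f {g g′} → g ≗ g′ → f ⊕ g ≗ f ⊕ g′
⊕-congˡ f = ⊕-cong {f} (λ _ → refl)

⊕-congʳ : ∀ g {f f′} → f ≗ f′ → f ⊕ g ≗ f′ ⊕ g
⊕-congʳ g f≗f′ = ⊕-cong f≗f′ (λ _ → refl)

shift : ℕ → Ser → Ser
shift zero    f         = f
shift (suc c) f zero    = + 0
shift (suc c) f (suc m) = shift c f m

shift-≤ : ∀ c f {m} → c ≤ m → shift c f m ≡ f (m ∸ c)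
shift-≤ zero    f _         = refl
shift-≤ (suc c) f (s≤s c≤m) = shift-≤ c f c≤m

shift-< : ∀ c f {m} → m < c → shift c f m ≡ + 0
shift-< (suc c) f {zero}  _         = refl
shift-< (suc c) f {suc m} (s≤s m<c) = shift-< c f m<c

shift-cong : ∀ c {f g} → f ≗ g → shift c f ≗ shift c g
shift-cong zero    f≗g m       = f≗g m
shift-cong (suc c) f≗g zero    = refl
shift-cong (suc c) f≗g (suc m) = shift-cong c f≗g m

shift-zeroS : ∀ c → shift c zeroS ≗ zeroS
shift-zeroS zero    m       = refl
shift-zeroS (suc c) zero    = refl
shift-zeroS (suc c) (suc m) = shift-zeroS c m

shift-⊕ : ∀ c f g → shift c (f ⊕ g) ≗ shift c f ⊕ shift c g
shift-⊕ zero    f g m       = refl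
shift-⊕ (suc c) f g zero    = refl
shift-⊕ (suc c) f g (suc m) = shift-⊕ c f g m

shift-*ˡ : ∀ c z f → shift c (λ m → z *ᶻ f m) ≗ λ m → z *ᶻ shift c f m
shift-*ˡ zero    z f m       = refl
shift-*ˡ (suc c) z f zero    = sym (ℤₚ.*-zeroʳ z)
shift-*ˡ (suc c) z f (suc m) = shift-*ˡ c z f m

shift-*ʳ : ∀ c z f → shift c (λ m → f m *ᶻ z) ≗ λ m → shift c f m *ᶻ z
shift-*ʳ zero    z f m       = refl
shift-*ʳ (suc c) z f zero    = sym (ℤₚ.*-zeroˡ z)
shift-*ʳ (suc c) z f (suc m) = shift-*ʳ c z f m

shift-shift : ∀ c d f → shift c (shift d f) ≗ shift (c + d) f
shift-shift zero    d f m       = refl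
shift-shift (suc c) d f zero    = refl
shift-shift (suc c) d f (suc m) = shift-shift c d f m

shift-monoS : ∀ c d → shift c (monoS d) ≗ monoS (c + d)
shift-monoS zero    d m       = refl
shift-monoS (suc c) d zero    = refl
shift-monoS (suc c) d (suc m) = shift-monoS c d m

shift-swap : ∀ a c i (K : ℕ → ℕ → ℤ) m →
  shift c (λ y → shift a (λ x → K x y) i) m ≡ shift a (λ x → shift c (K x) m) i
shift-swap zero    c i       K m = refl
shift-swap (suc a) c zero    K m = shift-zeroS c m
shift-swap (suc a) c (suc i) K m = shift-swap a c i K m

⊛-cong : ∀ {f f′ g g′} → f ≗ f′ → g ≗ g′ → f ⊛ g ≗ f′ ⊛ g′
⊛-cong f≗f′ g≗g′ m = Σ≤-cong m (λ k → cong₂ _*ᶻ_ (f≗f′ k) (g≗g′ (m ∸ k)))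

⊛-congˡ : ∀ f {g g′} → g ≗ g′ → f ⊛ g ≗ f ⊛ g′
⊛-congˡ f = ⊛-cong {f} (λ _ → refl)

⊛-congʳ : ∀ g {f f′} → f ≗ f′ → f ⊛ g ≗ f′ ⊛ g
⊛-congʳ g {f} {f′} f≗f′ = ⊛-cong {f} {f′} {g} f≗f′ (λ _ → refl)

⊛-comm : ∀ f g → f ⊛ g ≗ g ⊛ f
⊛-comm f g m = trans (Σ≤-reverse m _) (Σ≤-cong-≤ m λ k k≤m →
  trans (cong (λ t → f (m ∸ k) *ᶻ g t) (ℕₚ.m∸[m∸n]≡n k≤m)) (ℤₚ.*-comm (f (m ∸ k)) (g k)))

⊛-assoc : ∀ f g h → (f ⊛ g) ⊛ h ≗ f ⊛ (g ⊛ h)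
⊛-assoc f g h m = begin
  Σ≤ m (λ k → Σ≤ k (λ i → f i *ᶻ g (k ∸ i)) *ᶻ h (m ∸ k))
    ≡⟨ Σ≤-cong m (λ k → sym (Σ≤-*ʳ k (h (m ∸ k)) _)) ⟩
  Σ≤ m (λ k → Σ≤ k (λ i → f i *ᶻ g (k ∸ i) *ᶻ h (m ∸ k)))
    ≡⟨ Σ≤-triangle m (λ i k → f i *ᶻ g (k ∸ i) *ᶻ h (m ∸ k)) ⟩
  Σ≤ m (λ i → Σ≤ (m ∸ i) (λ j → f i *ᶻ g (i + j ∸ i) *ᶻ h (m ∸ (i + j))))
    ≡⟨ Σ≤-cong m (λ i → Σ≤-cong (m ∸ i) (λ j →
         trans (cong₂ (λ a b → f i *ᶻ g a *ᶻ h b) (ℕₚ.m+n∸m≡n i j) (sym (ℕₚ.∸-+-assoc m i j)))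
               (ℤₚ.*-assoc (f i) _ _))) ⟩
  Σ≤ m (λ i → Σ≤ (m ∸ i) (λ j → f i *ᶻ (g j *ᶻ h (m ∸ i ∸ j))))
    ≡⟨ Σ≤-cong m (λ i → Σ≤-*ˡ (m ∸ i) (f i) _) ⟩
  Σ≤ m (λ i → f i *ᶻ Σ≤ (m ∸ i) (λ j → g j *ᶻ h (m ∸ i ∸ j))) ∎
  where open ≡-Reasoning

⊛-distribˡ-⊕ : ∀ f g h → f ⊛ (g ⊕ h) ≗ f ⊛ g ⊕ f ⊛ h
⊛-distribˡ-⊕ f g h m = trans (Σ≤-cong m (λ k → ℤₚ.*-distribˡ-+ (f k) _ _)) (Σ≤-+ m _ _)

⊛-distribʳ-⊕ : ∀ f g h → (f ⊕ g) ⊛ h ≗ f ⊛ h ⊕ g ⊛ h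
⊛-distribʳ-⊕ f g h m = trans (Σ≤-cong m (λ k → ℤₚ.*-distribʳ-+ (h (m ∸ k)) (f k) _)) (Σ≤-+ m _ _)

⊛-distribˡ-⊝ : ∀ f g h → f ⊛ (g ⊝ h) ≗ (f ⊛ g) ⊝ (f ⊛ h)
⊛-distribˡ-⊝ f g h m = begin
  Σ≤ m (λ k → f k *ᶻ (g (m ∸ k) -ᶻ h (m ∸ k)))
    ≡⟨ Σ≤-cong m (λ k → ℤₚ.*-distribˡ-+ (f k) (g (m ∸ k)) (- h (m ∸ k))) ⟩
  Σ≤ m (λ k → f k *ᶻ g (m ∸ k) +ᶻ f k *ᶻ - h (m ∸ k))
    ≡⟨ Σ≤-+ m _ _ ⟩
  (f ⊛ g) m +ᶻ Σ≤ m (λ k → f k *ᶻ - h (m ∸ k))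
    ≡⟨ cong ((f ⊛ g) m +ᶻ_) (trans (Σ≤-cong m (λ k → sym (ℤₚ.neg-distribʳ-* (f k) (h (m ∸ k)))))
                                   (Σ≤-neg m _)) ⟩
  (f ⊛ g) m -ᶻ (f ⊛ h) m ∎
  where open ≡-Reasoning

monoS-⊛ : ∀ c f → monoS c ⊛ f ≗ shift c f
monoS-⊛ c f m with c ℕ.≤? m
... | yes c≤m = begin
  Σ≤ m (λ k → monoS c k *ᶻ f (m ∸ k))  ≡⟨ Σ≤-single m c off-c c≤m ⟩
  monoS c c *ᶻ f (m ∸ c)               ≡⟨ cong (λ b → (if b then + 1 else + 0) *ᶻ f (m ∸ c)) (≡ᵇ-refl c) ⟩
  + 1 *ᶻ f (m ∸ c)                     ≡⟨ ℤₚ.*-identityˡ (f (m ∸ c)) ⟩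
  f (m ∸ c)                            ≡⟨ shift-≤ c f c≤m ⟨
  shift c f m                          ∎
  where
  open ≡-Reasoning
  off-c : ∀ k → k ≢ c → monoS c k *ᶻ f (m ∸ k) ≡ + 0
  off-c k k≢c rewrite ≡ᵇ-false k≢c = ℤₚ.*-zeroˡ (f (m ∸ k))
... | no c≰m = trans (Σ≤-vanish m below-c) (sym (shift-< c f (ℕₚ.≰⇒> c≰m)))
  where
  below-c : ∀ k → k ≤ m → monoS c k *ᶻ f (m ∸ k) ≡ + 0
  below-c k k≤m rewrite ≡ᵇ-false {k} {c} (λ { refl → c≰m k≤m }) = ℤₚ.*-zeroˡ (f (m ∸ k))

⊛-identityˡ : ∀ f → oneS ⊛ f ≗ f
⊛-identityˡ = monoS-⊛ 0

⊛-identityʳ : ∀ f → f ⊛ oneS ≗ f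
⊛-identityʳ f m = trans (⊛-comm f oneS m) (⊛-identityˡ f m)

⊛-zeroˡ : ∀ f → zeroS ⊛ f ≗ zeroS
⊛-zeroˡ f m = trans (Σ≤-cong m (λ k → ℤₚ.*-zeroˡ (f (m ∸ k)))) (Σ≤-vanish m (λ _ _ → refl))

⊛-commutativeMonoid : CommutativeMonoid 0ℓ 0ℓ
⊛-commutativeMonoid = record
  { Carrier             = Ser
  ; _≈_                 = _≗_
  ; _∙_                 = _⊛_
  ; ε                   = oneS
  ; isCommutativeMonoid = record
    { isMonoid = record
      { isSemigroup = record
        { isMagma = record
          { isEquivalence = Setoid.isEquivalence (ℕ →-setoid ℤ)
          ; ∙-cong        = ⊛-cong
          }
        ; assoc = ⊛-assoc
        }
      ; identity = ⊛-identityˡ , ⊛-identityʳ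
      }
    ; comm = ⊛-comm
    }
  }

invUpTo-stable : ∀ f m j → j ≤ m → invUpTo f m j ≡ inv f j
invUpTo-stable f zero    .zero z≤n = refl
invUpTo-stable f (suc m) j     j≤1+m with ℕₚ.m≤n⇒m<n∨m≡n j≤1+m
... | inj₂ refl         = refl
... | inj₁ (s≤s j≤m) rewrite ≤ᵇ-true j≤m = invUpTo-stable f m j j≤m

inv-suc : ∀ f m → inv f (suc m) ≡ - Σ≤ m (λ k → f (suc k) *ᶻ inv f (m ∸ k))
inv-suc f m rewrite ≤ᵇ-false (ℕₚ.1+n≰n {m}) =
  cong -_ (Σ≤-cong m (λ k → cong (f (suc k) *ᶻ_) (invUpTo-stable f m (m ∸ k) (ℕₚ.m∸n≤m m k))))

⊛-inverseʳ : ∀ f → f 0 ≡ + 1 → f ⊛ inv f ≗ oneS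
⊛-inverseʳ f f0≡1 zero    rewrite f0≡1 = refl
⊛-inverseʳ f f0≡1 (suc m) = begin
  Σ≤ (suc m) (λ k → f k *ᶻ inv f (suc m ∸ k))  ≡⟨ Σ≤-suc m _ ⟩
  f 0 *ᶻ inv f (suc m) +ᶻ S                    ≡⟨ cong₂ (λ a b → a *ᶻ b +ᶻ S) f0≡1 (inv-suc f m) ⟩
  + 1 *ᶻ - S +ᶻ S                              ≡⟨ cancel S ⟩
  + 0                                          ∎
  where
  open ≡-Reasoning
  S = Σ≤ m (λ k → f (suc k) *ᶻ inv f (m ∸ k))
  cancel : ∀ s → + 1 *ᶻ - s +ᶻ s ≡ + 0
  cancel = ℤ-Solver.solve-∀

⊛-cancelʳ : ∀ f g → g 0 ≡ + 1 → f ⊛ g ⊛ inv g ≗ f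
⊛-cancelʳ f g g0≡1 = begin
  f ⊛ g ⊛ inv g    ≈⟨ ⊛-assoc f g (inv g) ⟩
  f ⊛ (g ⊛ inv g)  ≈⟨ ⊛-congˡ f (⊛-inverseʳ g g0≡1) ⟩
  f ⊛ oneS         ≈⟨ ⊛-identityʳ f ⟩
  f                ∎
  where open ≗-Reasoning

open CommutativeSemigroupProperties (CommutativeMonoid.commutativeSemigroup ⊛-commutativeMonoid)
  using (xy∙z≈xz∙y; x∙yz≈y∙xz)

shift-⊛ : ∀ c f g → shift c f ⊛ g ≗ shift c (f ⊛ g)
shift-⊛ c f g = begin
  shift c f ⊛ g      ≈⟨ ⊛-congʳ g (≗-sym (monoS-⊛ c f)) ⟩
  monoS c ⊛ f ⊛ g    ≈⟨ ⊛-assoc (monoS c) f g ⟩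
  monoS c ⊛ (f ⊛ g)  ≈⟨ monoS-⊛ c (f ⊛ g) ⟩
  shift c (f ⊛ g)    ∎
  where open ≗-Reasoning

oneS⊝monoS-split : ∀ c d → monoS c ⊛ (oneS ⊝ monoS d) ⊕ (oneS ⊝ monoS c) ≗ oneS ⊝ monoS (c + d)
oneS⊝monoS-split c d m = begin
  (monoS c ⊛ (oneS ⊝ monoS d)) m +ᶻ (oneS m -ᶻ monoS c m)
    ≡⟨ cong (_+ᶻ (oneS m -ᶻ monoS c m)) (⊛-distribˡ-⊝ (monoS c) oneS (monoS d) m) ⟩
  (monoS c ⊛ oneS) m -ᶻ (monoS c ⊛ monoS d) m +ᶻ (oneS m -ᶻ monoS c m)
    ≡⟨ cong₂ (λ a b → a -ᶻ b +ᶻ (oneS m -ᶻ monoS c m))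
             (⊛-identityʳ (monoS c) m) (trans (monoS-⊛ c (monoS d) m) (shift-monoS c d m)) ⟩
  monoS c m -ᶻ monoS (c + d) m +ᶻ (oneS m -ᶻ monoS c m)
    ≡⟨ telescope (monoS c m) (monoS (c + d) m) (oneS m) ⟩
  oneS m -ᶻ monoS (c + d) m ∎
  where
  open ≡-Reasoning
  telescope : ∀ x y z → x -ᶻ y +ᶻ (z -ᶻ x) ≡ z -ᶻ y
  telescope = ℤ-Solver.solve-∀

-- Gaussian coefficients in base q²

poch : ℕ → Ser
poch = qPoch 2 2

poch-constant : ∀ k → poch k 0 ≡ + 1
poch-constant zero = refl
poch-constant (suc k) rewrite poch-constant k = refl

qBinom : ℕ → ℕ → Ser
qBinom _       zero    = oneS
qBinom zero    (suc k) = zeroS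
qBinom (suc N) (suc k) = shift (2 + 2 * k) (qBinom N (suc k)) ⊕ qBinom N k

qBinom-vanish : ∀ {N k} → N < k → qBinom N k ≗ zeroS
qBinom-vanish {zero}  {suc k} _         m = refl
qBinom-vanish {suc N} {suc k} (s≤s N<k) m = cong₂ _+ᶻ_
  (trans (shift-cong (2 + 2 * k) (qBinom-vanish (ℕₚ.m<n⇒m<1+n N<k)) m) (shift-zeroS (2 + 2 * k) m))
  (qBinom-vanish N<k m)

pochFactor : ℕ → Ser
pochFactor j = oneS ⊝ monoS (2 + 2 * j)

qBinom-poch-lower : ∀ N k → qBinom N k ⊛ poch k ⊛ poch (N ∸ k) ≗ poch N →
  qBinom N k ⊛ poch (suc k) ⊛ poch (N ∸ k) ≗ poch N ⊛ pochFactor k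
qBinom-poch-lower N k IH = begin
  G ⊛ (poch k ⊛ pochFactor k) ⊛ poch (N ∸ k)  ≈⟨ ⊛-congʳ (poch (N ∸ k)) (≗-sym (⊛-assoc G (poch k) (pochFactor k))) ⟩
  G ⊛ poch k ⊛ pochFactor k ⊛ poch (N ∸ k)    ≈⟨ xy∙z≈xz∙y (G ⊛ poch k) (pochFactor k) (poch (N ∸ k)) ⟩
  G ⊛ poch k ⊛ poch (N ∸ k) ⊛ pochFactor k    ≈⟨ ⊛-congʳ (pochFactor k) IH ⟩
  poch N ⊛ pochFactor k                        ∎
  where
  open ≗-Reasoning
  G = qBinom N k

qBinom-poch-upper : ∀ N k → k < N → qBinom N (suc k) ⊛ poch (suc k) ⊛ poch (N ∸ suc k) ≗ poch N →
  shift (2 + 2 * k) (qBinom N (suc k)) ⊛ poch (suc k) ⊛ poch (N ∸ k)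
    ≗ poch N ⊛ (monoS (2 + 2 * k) ⊛ pochFactor (N ∸ suc k))
qBinom-poch-upper N k k<N IH = begin
  shift c G ⊛ poch (suc k) ⊛ poch (N ∸ k)
    ≡⟨ cong (λ t → shift c G ⊛ poch (suc k) ⊛ poch t) (ℕₚ.+-∸-assoc 1 k<N) ⟩
  shift c G ⊛ poch (suc k) ⊛ (poch j ⊛ pochFactor j)
    ≈⟨ ⊛-congʳ (poch j ⊛ pochFactor j) (shift-⊛ c G (poch (suc k))) ⟩
  shift c (G ⊛ poch (suc k)) ⊛ (poch j ⊛ pochFactor j)
    ≈⟨ shift-⊛ c (G ⊛ poch (suc k)) (poch j ⊛ pochFactor j) ⟩
  shift c (G ⊛ poch (suc k) ⊛ (poch j ⊛ pochFactor j))
    ≈⟨ shift-cong c (≗-sym (⊛-assoc (G ⊛ poch (suc k)) (poch j) (pochFactor j))) ⟩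
  shift c (G ⊛ poch (suc k) ⊛ poch j ⊛ pochFactor j)
    ≈⟨ shift-cong c (⊛-congʳ (pochFactor j) IH) ⟩
  shift c (poch N ⊛ pochFactor j)
    ≈⟨ ≗-sym (monoS-⊛ c (poch N ⊛ pochFactor j)) ⟩
  monoS c ⊛ (poch N ⊛ pochFactor j)
    ≈⟨ x∙yz≈y∙xz (monoS c) (poch N) (pochFactor j) ⟩
  poch N ⊛ (monoS c ⊛ pochFactor j) ∎
  where
  open ≗-Reasoning
  c = 2 + 2 * k
  j = N ∸ suc k
  G = qBinom N (suc k)

qBinom-poch : ∀ N k → k ≤ N → qBinom N k ⊛ poch k ⊛ poch (N ∸ k) ≗ poch N
qBinom-poch N zero _ = begin
  oneS ⊛ oneS ⊛ poch N  ≈⟨ ⊛-congʳ (poch N) (⊛-identityˡ oneS) ⟩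
  oneS ⊛ poch N         ≈⟨ ⊛-identityˡ (poch N) ⟩
  poch N                ∎
  where open ≗-Reasoning
qBinom-poch (suc N) (suc k) (s≤s k≤N) = begin
  (shift c G₁ ⊕ G₀) ⊛ poch (suc k) ⊛ poch (N ∸ k)
    ≈⟨ ⊛-congʳ (poch (N ∸ k)) (⊛-distribʳ-⊕ (shift c G₁) G₀ (poch (suc k))) ⟩
  (shift c G₁ ⊛ poch (suc k) ⊕ G₀ ⊛ poch (suc k)) ⊛ poch (N ∸ k)
    ≈⟨ ⊛-distribʳ-⊕ (shift c G₁ ⊛ poch (suc k)) (G₀ ⊛ poch (suc k)) (poch (N ∸ k)) ⟩
  upper ⊕ G₀ ⊛ poch (suc k) ⊛ poch (N ∸ k)
    ≈⟨ ⊕-congˡ upper (qBinom-poch-lower N k (qBinom-poch N k k≤N)) ⟩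
  upper ⊕ poch N ⊛ pochFactor k
    ≈⟨ combine (ℕₚ.m≤n⇒m<n∨m≡n k≤N) ⟩
  poch N ⊛ pochFactor N ∎
  where
  open ≗-Reasoning
  c  = 2 + 2 * k
  G₁ = qBinom N (suc k)
  G₀ = qBinom N k
  upper = shift c G₁ ⊛ poch (suc k) ⊛ poch (N ∸ k)
  combine : k < N ⊎ k ≡ N → upper ⊕ poch N ⊛ pochFactor k ≗ poch N ⊛ pochFactor N
  combine (inj₁ k<N) = begin
    upper ⊕ poch N ⊛ pochFactor k
      ≈⟨ ⊕-congʳ (poch N ⊛ pochFactor k) (qBinom-poch-upper N k k<N (qBinom-poch N (suc k) k<N)) ⟩
    poch N ⊛ (monoS c ⊛ pochFactor j) ⊕ poch N ⊛ pochFactor k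
      ≈⟨ ≗-sym (⊛-distribˡ-⊕ (poch N) (monoS c ⊛ pochFactor j) (pochFactor k)) ⟩
    poch N ⊛ (monoS c ⊛ pochFactor j ⊕ pochFactor k)
      ≈⟨ ⊛-congˡ (poch N) (oneS⊝monoS-split c (2 + 2 * j)) ⟩
    poch N ⊛ (oneS ⊝ monoS (c + (2 + 2 * j)))
      ≡⟨ cong (λ t → poch N ⊛ (oneS ⊝ monoS t)) exponent ⟩
    poch N ⊛ pochFactor N ∎
    where
    j = N ∸ suc k
    exponent : c + (2 + 2 * j) ≡ 2 + 2 * N
    exponent = trans (double-sum k j) (cong (λ t → 2 + 2 * t) (ℕₚ.m+[n∸m]≡n k<N))
      where
      double-sum : ∀ k j → 2 + 2 * k + (2 + 2 * j) ≡ 2 + 2 * (suc k + j)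
      double-sum = ℕ-Solver.solve-∀
  combine (inj₂ refl) = begin
    upper ⊕ poch k ⊛ pochFactor k
      ≈⟨ ⊕-congʳ (poch k ⊛ pochFactor k) upper≗0 ⟩
    zeroS ⊕ poch k ⊛ pochFactor k
      ≈⟨ (λ m → ℤₚ.+-identityˡ _) ⟩
    poch k ⊛ pochFactor k ∎
    where
    upper≗0 : upper ≗ zeroS
    upper≗0 = begin
      shift c G₁ ⊛ poch (suc k) ⊛ poch (k ∸ k)
        ≈⟨ ⊛-congʳ (poch (k ∸ k)) (⊛-congʳ (poch (suc k)) (λ m →
             trans (shift-cong c (qBinom-vanish {k} ℕₚ.≤-refl) m) (shift-zeroS c m))) ⟩
      zeroS ⊛ poch (suc k) ⊛ poch (k ∸ k)  ≈⟨ ⊛-congʳ (poch (k ∸ k)) (⊛-zeroˡ (poch (suc k))) ⟩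
      zeroS ⊛ poch (k ∸ k)                 ≈⟨ ⊛-zeroˡ (poch (k ∸ k)) ⟩
      zeroS                                ∎

gaussian≗qBinom : ∀ N k → gaussian 2 N k ≗ qBinom N k
gaussian≗qBinom N k with k ℕ.≤? N
... | no k≰N = λ m → trans (cong (λ b → (if b then gaussAB 2 (N ∸ k) k else zeroS) m) (≤ᵇ-false k≰N))
                           (sym (qBinom-vanish (ℕₚ.≰⇒> k≰N) m))
... | yes k≤N = begin
  gaussian 2 N k
    ≡⟨ cong (λ b → if b then gaussAB 2 (N ∸ k) k else zeroS) (≤ᵇ-true k≤N) ⟩
  poch (N ∸ k + k) ⊛ inv (poch (N ∸ k)) ⊛ inv (poch k)
    ≡⟨ cong (λ t → poch t ⊛ inv (poch (N ∸ k)) ⊛ inv (poch k)) (ℕₚ.m∸n+n≡m k≤N) ⟩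
  poch N ⊛ inv (poch (N ∸ k)) ⊛ inv (poch k)
    ≈⟨ ⊛-congʳ (inv (poch k)) (⊛-congʳ (inv (poch (N ∸ k))) (≗-sym (qBinom-poch N k k≤N))) ⟩
  qBinom N k ⊛ poch k ⊛ poch (N ∸ k) ⊛ inv (poch (N ∸ k)) ⊛ inv (poch k)
    ≈⟨ ⊛-congʳ (inv (poch k)) (⊛-cancelʳ (qBinom N k ⊛ poch k) (poch (N ∸ k)) (poch-constant (N ∸ k))) ⟩
  qBinom N k ⊛ poch k ⊛ inv (poch k)
    ≈⟨ ⊛-cancelʳ (qBinom N k) (poch k) (poch-constant k) ⟩
  qBinom N k ∎
  where open ≗-Reasoning

-- Series in x, y and q

infix 4 _≈₃_
_≈₃_ : Ser3 → Ser3 → Set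
F ≈₃ G = ∀ i j m → F i j m ≡ G i j m

⊕₃-commutativeMonoid : CommutativeMonoid 0ℓ 0ℓ
⊕₃-commutativeMonoid = commutativeMonoid (commutativeMonoid (commutativeMonoid ℤₚ.+-0-commutativeMonoid))
  where open Pointwise ℕ using (commutativeMonoid)

open CommutativeMonoid ⊕₃-commutativeMonoid using ()
  renaming ( setoid to ≈₃-setoid; refl to ≈₃-refl; reflexive to ≈₃-reflexive; sym to ≈₃-sym; trans to ≈₃-trans
           ; identityˡ to ⊕₃-identityˡ; identityʳ to ⊕₃-identityʳ; comm to ⊕₃-comm)
open CommutativeSemigroupProperties (CommutativeMonoid.commutativeSemigroup ⊕₃-commutativeMonoid)
  using () renaming (interchange to ⊕₃-interchange)

module ≈₃-Reasoning = SetoidReasoning ≈₃-setoid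

⊕₃-cong : ∀ {F F′ G G′} → F ≈₃ F′ → G ≈₃ G′ → F ⊕₃ G ≈₃ F′ ⊕₃ G′
⊕₃-cong F≈F′ G≈G′ i j m = cong₂ _+ᶻ_ (F≈F′ i j m) (G≈G′ i j m)

⊕₃-congˡ : ∀ F {G G′} → G ≈₃ G′ → F ⊕₃ G ≈₃ F ⊕₃ G′
⊕₃-congˡ F = ⊕₃-cong {F} ≈₃-refl

⊕₃-congʳ : ∀ G {F F′} → F ≈₃ F′ → F ⊕₃ G ≈₃ F′ ⊕₃ G
⊕₃-congʳ G {F} {F′} F≈F′ = ⊕₃-cong {F} {F′} {G} F≈F′ ≈₃-refl

shift₃ : ℕ → ℕ → ℕ → Ser3 → Ser3
shift₃ a b c F i j m = shift a (λ i′ → shift b (λ j′ → shift c (F i′ j′) m) j) i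

shift₃-cong : ∀ a b c {F G} → F ≈₃ G → shift₃ a b c F ≈₃ shift₃ a b c G
shift₃-cong a b c F≈G i j m =
  shift-cong a (λ i′ → shift-cong b (λ j′ → shift-cong c (F≈G i′ j′) m) j) i

shift₃-≡ : ∀ {a a′ b b′ c c′} F → a ≡ a′ → b ≡ b′ → c ≡ c′ → shift₃ a b c F ≈₃ shift₃ a′ b′ c′ F
shift₃-≡ F refl refl refl = ≈₃-refl

shift₃-zero3 : ∀ a b c → shift₃ a b c zero3 ≈₃ zero3
shift₃-zero3 a b c i j m = trans
  (shift-cong a (λ i′ → trans (shift-cong b (λ j′ → shift-zeroS c m) j) (shift-zeroS b j)) i)
  (shift-zeroS a i)

shift₃-vanish : ∀ a b c {F} → F ≈₃ zero3 → shift₃ a b c F ≈₃ zero3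
shift₃-vanish a b c F≈0 = ≈₃-trans (shift₃-cong a b c F≈0) (shift₃-zero3 a b c)

shift₃-⊕₃ : ∀ a b c F G → shift₃ a b c (F ⊕₃ G) ≈₃ shift₃ a b c F ⊕₃ shift₃ a b c G
shift₃-⊕₃ a b c F G i j m = trans
  (shift-cong a (λ i′ → trans (shift-cong b (λ j′ → shift-⊕ c (F i′ j′) (G i′ j′) m) j) (shift-⊕ b _ _ j)) i)
  (shift-⊕ a _ _ i)

shift₃-shift₃ : ∀ a b c a′ b′ c′ F →
  shift₃ a b c (shift₃ a′ b′ c′ F) ≈₃ shift₃ (a + a′) (b + b′) (c + c′) F
shift₃-shift₃ a b c a′ b′ c′ F i j m = begin
  shift a (λ i₁ → shift b (λ j₁ → shift c (λ m₁ →
    shift a′ (λ i₂ → shift b′ (λ j₂ → shift c′ (F i₂ j₂) m₁) j₁) i₁) m) j) i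
    ≡⟨ shift-cong a (λ i₁ → shift-cong b (λ j₁ →
         trans (shift-swap a′ c i₁ (λ i₂ m₁ → shift b′ (λ j₂ → shift c′ (F i₂ j₂) m₁) j₁) m)
               (shift-cong a′ (λ i₂ →
                  trans (shift-swap b′ c j₁ (λ j₂ m₁ → shift c′ (F i₂ j₂) m₁) m)
                        (shift-cong b′ (λ j₂ → shift-shift c c′ (F i₂ j₂) m) j₁)) i₁)) j) i ⟩
  shift a (λ i₁ → shift b (λ j₁ →
    shift a′ (λ i₂ → shift b′ (λ j₂ → shift (c + c′) (F i₂ j₂) m) j₁) i₁) j) i
    ≡⟨ shift-cong a (λ i₁ →
         trans (shift-swap a′ b i₁ (λ i₂ j₁ → shift b′ (λ j₂ → shift (c + c′) (F i₂ j₂) m) j₁) j)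
               (shift-cong a′ (λ i₂ → shift-shift b b′ _ j) i₁)) i ⟩
  shift a (λ i₁ → shift a′ (λ i₂ → shift (b + b′) (λ j₂ → shift (c + c′) (F i₂ j₂) m) j) i₁) i
    ≡⟨ shift-shift a a′ _ i ⟩
  shift₃ (a + a′) (b + b′) (c + c′) F i j m ∎
  where open ≡-Reasoning

shift₃-⊕₃-shift₃ : ∀ a b c a₁ b₁ c₁ a₂ b₂ c₂ F G →
  shift₃ a b c (shift₃ a₁ b₁ c₁ F ⊕₃ shift₃ a₂ b₂ c₂ G)
    ≈₃ shift₃ (a + a₁) (b + b₁) (c + c₁) F ⊕₃ shift₃ (a + a₂) (b + b₂) (c + c₂) G
shift₃-⊕₃-shift₃ a b c a₁ b₁ c₁ a₂ b₂ c₂ F G = ≈₃-trans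
  (shift₃-⊕₃ a b c (shift₃ a₁ b₁ c₁ F) (shift₃ a₂ b₂ c₂ G))
  (⊕₃-cong (shift₃-shift₃ a b c a₁ b₁ c₁ F) (shift₃-shift₃ a b c a₂ b₂ c₂ G))

if-∧-*ᶻ : ∀ p q → (if p ∧ q then + 1 else + 0) ≡ (if p then + 1 else + 0) *ᶻ (if q then + 1 else + 0)
if-∧-*ᶻ true  q = sym (ℤₚ.*-identityˡ _)
if-∧-*ᶻ false q = refl

mono3-factor : ∀ a b c i j m → mono3 a b c i j m ≡ monoS a i *ᶻ (monoS b j *ᶻ monoS c m)
mono3-factor a b c i j m =
  trans (if-∧-*ᶻ (i ≡ᵇ a) _) (cong (monoS a i *ᶻ_) (if-∧-*ᶻ (j ≡ᵇ b) (m ≡ᵇ c)))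

shift₃-mono3 : ∀ a b c a′ b′ c′ → shift₃ a b c (mono3 a′ b′ c′) ≈₃ mono3 (a + a′) (b + b′) (c + c′)
shift₃-mono3 a b c a′ b′ c′ i j m = begin
  shift a (λ i′ → shift b (λ j′ → shift c (mono3 a′ b′ c′ i′ j′) m) j) i
    ≡⟨ shift-cong a (λ i′ → shift-cong b (λ j′ → factor-m i′ j′) j) i ⟩
  shift a (λ i′ → shift b (λ j′ → monoS a′ i′ *ᶻ (monoS b′ j′ *ᶻ shift c (monoS c′) m)) j) i
    ≡⟨ shift-cong a (λ i′ → trans (shift-*ˡ b (monoS a′ i′) _ j)
                                  (cong (monoS a′ i′ *ᶻ_) (shift-*ʳ b _ (monoS b′) j))) i ⟩
  shift a (λ i′ → monoS a′ i′ *ᶻ (shift b (monoS b′) j *ᶻ shift c (monoS c′) m)) i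
    ≡⟨ shift-*ʳ a _ (monoS a′) i ⟩
  shift a (monoS a′) i *ᶻ (shift b (monoS b′) j *ᶻ shift c (monoS c′) m)
    ≡⟨ cong₂ _*ᶻ_ (shift-monoS a a′ i) (cong₂ _*ᶻ_ (shift-monoS b b′ j) (shift-monoS c c′ m)) ⟩
  monoS (a + a′) i *ᶻ (monoS (b + b′) j *ᶻ monoS (c + c′) m)
    ≡⟨ mono3-factor (a + a′) (b + b′) (c + c′) i j m ⟨
  mono3 (a + a′) (b + b′) (c + c′) i j m ∎
  where
  open ≡-Reasoning
  factor-m : ∀ i′ j′ → shift c (mono3 a′ b′ c′ i′ j′) m
                       ≡ monoS a′ i′ *ᶻ (monoS b′ j′ *ᶻ shift c (monoS c′) m)
  factor-m i′ j′ = trans (shift-cong c (mono3-factor a′ b′ c′ i′ j′) m)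
    (trans (shift-*ˡ c (monoS a′ i′) _ m) (cong (monoS a′ i′ *ᶻ_) (shift-*ˡ c (monoS b′ j′) (monoS c′) m)))

mono3-⊛₃ : ∀ a b c F → mono3 a b c ⊛₃ F ≈₃ shift₃ a b c F
mono3-⊛₃ a b c F i j m = begin
  Σ≤ i (λ i′ → Σ≤ j (λ j′ → Σ≤ m (λ m′ → mono3 a b c i′ j′ m′ *ᶻ F (i ∸ i′) (j ∸ j′) (m ∸ m′))))
    ≡⟨ Σ≤-cong i (λ i′ → Σ≤-cong j (λ j′ → factor-m i′ j′)) ⟩
  Σ≤ i (λ i′ → Σ≤ j (λ j′ → monoS a i′ *ᶻ (monoS b j′ *ᶻ (monoS c ⊛ F (i ∸ i′) (j ∸ j′)) m)))
    ≡⟨ Σ≤-cong i (λ i′ → Σ≤-cong j (λ j′ →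
         cong (λ t → monoS a i′ *ᶻ (monoS b j′ *ᶻ t)) (monoS-⊛ c (F (i ∸ i′) (j ∸ j′)) m))) ⟩
  Σ≤ i (λ i′ → Σ≤ j (λ j′ → monoS a i′ *ᶻ (monoS b j′ *ᶻ shift c (F (i ∸ i′) (j ∸ j′)) m)))
    ≡⟨ Σ≤-cong i (λ i′ → Σ≤-*ˡ j (monoS a i′) _) ⟩
  Σ≤ i (λ i′ → monoS a i′ *ᶻ (monoS b ⊛ (λ j′ → shift c (F (i ∸ i′) j′) m)) j)
    ≡⟨ Σ≤-cong i (λ i′ → cong (monoS a i′ *ᶻ_) (monoS-⊛ b _ j)) ⟩
  (monoS a ⊛ (λ i′ → shift b (λ j′ → shift c (F i′ j′) m) j)) i
    ≡⟨ monoS-⊛ a _ i ⟩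
  shift₃ a b c F i j m ∎
  where
  open ≡-Reasoning
  factor-m : ∀ i′ j′ → Σ≤ m (λ m′ → mono3 a b c i′ j′ m′ *ᶻ F (i ∸ i′) (j ∸ j′) (m ∸ m′))
                       ≡ monoS a i′ *ᶻ (monoS b j′ *ᶻ (monoS c ⊛ F (i ∸ i′) (j ∸ j′)) m)
  factor-m i′ j′ = begin
    Σ≤ m (λ m′ → mono3 a b c i′ j′ m′ *ᶻ f (m ∸ m′))
      ≡⟨ Σ≤-cong m (λ m′ → trans (cong (_*ᶻ f (m ∸ m′)) (mono3-factor a b c i′ j′ m′))
                                 (reassoc (monoS a i′) (monoS b j′) (monoS c m′) (f (m ∸ m′)))) ⟩
    Σ≤ m (λ m′ → monoS a i′ *ᶻ (monoS b j′ *ᶻ (monoS c m′ *ᶻ f (m ∸ m′))))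
      ≡⟨ Σ≤-*ˡ m (monoS a i′) _ ⟩
    monoS a i′ *ᶻ Σ≤ m (λ m′ → monoS b j′ *ᶻ (monoS c m′ *ᶻ f (m ∸ m′)))
      ≡⟨ cong (monoS a i′ *ᶻ_) (Σ≤-*ˡ m (monoS b j′) _) ⟩
    monoS a i′ *ᶻ (monoS b j′ *ᶻ (monoS c ⊛ f) m) ∎
    where
    f = F (i ∸ i′) (j ∸ j′)
    reassoc : ∀ x y z w → x *ᶻ (y *ᶻ z) *ᶻ w ≡ x *ᶻ (y *ᶻ (z *ᶻ w))
    reassoc = ℤ-Solver.solve-∀

liftQ-cong : ∀ {f g} → f ≗ g → liftQ f ≈₃ liftQ g
liftQ-cong f≗g i j m with (i ≡ᵇ 0) ∧ (j ≡ᵇ 0)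
... | true  = f≗g m
... | false = refl

liftQ-⊕ : ∀ f g → liftQ (f ⊕ g) ≈₃ liftQ f ⊕₃ liftQ g
liftQ-⊕ f g i j m with (i ≡ᵇ 0) ∧ (j ≡ᵇ 0)
... | true  = refl
... | false = refl

liftQ-zeroS : liftQ zeroS ≈₃ zero3
liftQ-zeroS i j m with (i ≡ᵇ 0) ∧ (j ≡ᵇ 0)
... | true  = refl
... | false = refl

liftQ-oneS : liftQ oneS ≈₃ mono3 0 0 0
liftQ-oneS i j m with i ≡ᵇ 0 | j ≡ᵇ 0
... | true  | true  = refl
... | true  | false = refl
... | false | _     = refl

liftQ-shift : ∀ c f → liftQ (shift c f) ≈₃ shift₃ 0 0 c (liftQ f)
liftQ-shift c f i j m with (i ≡ᵇ 0) ∧ (j ≡ᵇ 0)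
... | true  = refl
... | false = sym (shift-zeroS c m)

-- Sums over lists and ranges

onlyIf : Bool → Ser3 → Ser3
onlyIf p F = if p then F else zero3

onlyIf-cong : ∀ p {F G} → F ≈₃ G → onlyIf p F ≈₃ onlyIf p G
onlyIf-cong true  F≈G = F≈G
onlyIf-cong false F≈G = ≈₃-refl

onlyIf-false : ∀ {p} F → p ≡ false → onlyIf p F ≈₃ zero3
onlyIf-false F refl = ≈₃-refl

sumOver-cong : ∀ L {F G : List ℕ → Ser3} → (∀ l → F l ≈₃ G l) → sumOver L F ≈₃ sumOver L G
sumOver-cong []      F≈G = ≈₃-refl
sumOver-cong (l ∷ L) F≈G = ⊕₃-cong (F≈G l) (sumOver-cong L F≈G)

sumOver-++ : ∀ xs ys (F : List ℕ → Ser3) → sumOver (xs ++ ys) F ≈₃ sumOver xs F ⊕₃ sumOver ys F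
sumOver-++ []       ys F = ≈₃-sym (⊕₃-identityˡ (sumOver ys F))
sumOver-++ (x ∷ xs) ys F = ≈₃-trans (⊕₃-congˡ (F x) (sumOver-++ xs ys F))
                                    (λ i j m → sym (ℤₚ.+-assoc (F x i j m) _ _))

sumOver-map : ∀ (g : List ℕ → List ℕ) L (F : List ℕ → Ser3) → sumOver (map g L) F ≈₃ sumOver L (F ∘ g)
sumOver-map g []      F = ≈₃-refl
sumOver-map g (l ∷ L) F = ⊕₃-congˡ (F (g l)) (sumOver-map g L F)

sumOver-onlyIf : ∀ p L (F : List ℕ → Ser3) → sumOver L (λ l → onlyIf p (F l)) ≈₃ onlyIf p (sumOver L F)
sumOver-onlyIf true  L       F = ≈₃-refl
sumOver-onlyIf false []      F = ≈₃-refl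
sumOver-onlyIf false (l ∷ L) F = ≈₃-trans (⊕₃-identityˡ _) (sumOver-onlyIf false L F)

sumOver-shift₃ : ∀ a b c L (F : List ℕ → Ser3) → sumOver L (λ l → shift₃ a b c (F l)) ≈₃ shift₃ a b c (sumOver L F)
sumOver-shift₃ a b c []      F = ≈₃-sym (shift₃-zero3 a b c)
sumOver-shift₃ a b c (l ∷ L) F = ≈₃-trans (⊕₃-congˡ (shift₃ a b c (F l)) (sumOver-shift₃ a b c L F))
                                          (≈₃-sym (shift₃-⊕₃ a b c (F l) (sumOver L F)))

∑< : ℕ → (ℕ → Ser3) → Ser3
∑< zero    F = zero3
∑< (suc N) F = F 0 ⊕₃ ∑< N (F ∘ suc)

∑<-cong : ∀ N {F G : ℕ → Ser3} → (∀ x → x < N → F x ≈₃ G x) → ∑< N F ≈₃ ∑< N G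
∑<-cong zero    F≈G = ≈₃-refl
∑<-cong (suc N) F≈G = ⊕₃-cong (F≈G 0 (s≤s z≤n)) (∑<-cong N (λ x x<N → F≈G (suc x) (s≤s x<N)))

∑<-vanish : ∀ N {F : ℕ → Ser3} → (∀ x → F x ≈₃ zero3) → ∑< N F ≈₃ zero3
∑<-vanish zero    F≈0 = ≈₃-refl
∑<-vanish (suc N) F≈0 = ≈₃-trans (⊕₃-cong (F≈0 0) (∑<-vanish N (F≈0 ∘ suc))) (⊕₃-identityˡ zero3)

∑<-⊕₃ : ∀ N (F G : ℕ → Ser3) → ∑< N (λ x → F x ⊕₃ G x) ≈₃ ∑< N F ⊕₃ ∑< N G
∑<-⊕₃ zero    F G = ≈₃-sym (⊕₃-identityˡ zero3)
∑<-⊕₃ (suc N) F G = ≈₃-trans (⊕₃-congˡ (F 0 ⊕₃ G 0) (∑<-⊕₃ N (F ∘ suc) (G ∘ suc)))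
                             (⊕₃-interchange (F 0) (G 0) (∑< N (F ∘ suc)) (∑< N (G ∘ suc)))

∑<-single : ∀ N c (F : ℕ → Ser3) → c < N → ∑< N (λ x → onlyIf (x ≡ᵇ c) (F x)) ≈₃ F c
∑<-single (suc N) zero    F _ =
  ≈₃-trans (⊕₃-congˡ (F 0) (∑<-vanish N {λ _ → zero3} (λ _ → ≈₃-refl))) (⊕₃-identityʳ (F 0))
∑<-single (suc N) (suc c) F (s≤s c<N) =
  ≈₃-trans (⊕₃-identityˡ _) (∑<-single N c (F ∘ suc) c<N)

-- For H < k no term survives while H ∸ k = 0, hence the hypothesis on F 0.
∑<-offset : ∀ N H k (F : ℕ → Ser3) → F 0 ≈₃ zero3 → H < N →
  ∑< N (λ b → onlyIf (H ≡ᵇ k + b) (F b)) ≈₃ F (H ∸ k)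
∑<-offset N H k F F0≈0 H<N with k ℕ.≤? H
... | yes k≤H = ≈₃-trans (∑<-cong N (λ b _ → ≈₃-reflexive (cong (λ p → onlyIf p (F b)) (same-test b))))
                         (∑<-single N (H ∸ k) F (ℕₚ.≤-<-trans (ℕₚ.m∸n≤m H k) H<N))
  where
  same-test : ∀ b → (H ≡ᵇ k + b) ≡ (b ≡ᵇ H ∸ k)
  same-test b = does-⇔ (mk⇔ (λ { refl → sym (ℕₚ.m+n∸m≡n k b) })
                            (λ { refl → sym (ℕₚ.m+[n∸m]≡n k≤H) }))
                       (H ℕ.≟ k + b) (b ℕ.≟ H ∸ k)
... | no k≰H = begin
  ∑< N (λ b → onlyIf (H ≡ᵇ k + b) (F b))
    ≈⟨ ∑<-vanish N (λ b → onlyIf-false (F b) (≡ᵇ-false (λ H≡k+b → k≰H (subst (k ≤_) (sym H≡k+b) (ℕₚ.m≤m+n k b))))) ⟩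
  zero3
    ≈⟨ F0≈0 ⟨
  F 0
    ≡⟨ cong F (ℕₚ.m≤n⇒m∸n≡0 (ℕₚ.<⇒≤ (ℕₚ.≰⇒> k≰H))) ⟨
  F (H ∸ k) ∎
  where open ≈₃-Reasoning

sumOver-concatMap-applyUpTo : ∀ (g : ℕ → List (List ℕ)) (f : ℕ → ℕ) N (F : List ℕ → Ser3) →
  sumOver (concatMap g (applyUpTo f N)) F ≈₃ ∑< N (λ x → sumOver (g (f x)) F)
sumOver-concatMap-applyUpTo g f zero    F = ≈₃-refl
sumOver-concatMap-applyUpTo g f (suc N) F =
  ≈₃-trans (sumOver-++ (g (f 0)) _ F) (⊕₃-congˡ (sumOver (g (f 0)) F) (sumOver-concatMap-applyUpTo g (f ∘ suc) N F))

sumOver-listsOf-upTo : ∀ n N (F : List ℕ → Ser3) →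
  sumOver (listsOf (suc n) (upTo N)) F ≈₃ ∑< N (λ x → sumOver (listsOf n (upTo N)) (F ∘ (x ∷_)))
sumOver-listsOf-upTo n N F = ≈₃-trans
  (sumOver-concatMap-applyUpTo (λ x → map (x ∷_) (listsOf n (upTo N))) (λ x → x) N F)
  (∑<-cong N (λ x _ → sumOver-map (x ∷_) (listsOf n (upTo N)) F))

-- Removing the largest part

isOdd-suc : ∀ n → isOdd (suc n) ≡ not (isOdd n)
isOdd-suc zero    = refl
isOdd-suc (suc n) = sym (trans (cong not (isOdd-suc n)) (Boolₚ.not-involutive (isOdd n)))

isOdd-double : ∀ t → isOdd (2 * t) ≡ false
isOdd-double zero    = refl
isOdd-double (suc t) = trans (cong isOdd (ℕₚ.*-suc 2 t)) (isOdd-double t)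

isOdd-1+double : ∀ t → isOdd (1 + 2 * t) ≡ true
isOdd-1+double t = trans (isOdd-suc (2 * t)) (cong not (isOdd-double t))

≡ᵇ-false-parity : ∀ {m n p} → isOdd m ≡ p → isOdd n ≡ not p → (m ≡ᵇ n) ≡ false
≡ᵇ-false-parity {m} {n} refl odd-n = ≡ᵇ-false {m} {n} (λ { refl → Boolₚ.not-¬ refl odd-n })

[odd] [even] sameParityGap : ℕ → ℕ
[odd]  H = if isOdd H then 1 else 0
[even] H = if isOdd H then 0 else 1
sameParityGap H = if isOdd H then 2 else 4

2≤sameParityGap : ∀ H → 2 ≤ sameParityGap H
2≤sameParityGap H with isOdd H
... | true  = ℕₚ.≤-refl
... | false = s≤s (s≤s z≤n)

gapOK-zero : ∀ b → gapOK 0 b ≡ false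
gapOK-zero b rewrite ℕₚ.+-comm b 4 | ℕₚ.+-comm b 3 with isEven b
... | true  = refl
... | false = refl

onlyIf-gapOK : ∀ H b X →
  onlyIf (gapOK H b) X ≈₃ onlyIf (H ≡ᵇ sameParityGap H + b) X ⊕₃ onlyIf (H ≡ᵇ 3 + b) X
onlyIf-gapOK H b X with isOdd H in odd-H | isOdd b in odd-b
... | true  | true  rewrite ℕₚ.+-comm b 2 | ≡ᵇ-false-parity {H} {3 + b} odd-H (trans (isOdd-suc b) (cong not odd-b))
  = ≈₃-sym (⊕₃-identityʳ _)
... | true  | false rewrite ℕₚ.+-comm b 3 | ≡ᵇ-false-parity {H} {2 + b} odd-H odd-b
  = ≈₃-sym (⊕₃-identityˡ _)
... | false | true  rewrite ℕₚ.+-comm b 3 | ≡ᵇ-false-parity {H} {4 + b} odd-H odd-b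
  = ≈₃-sym (⊕₃-identityˡ _)
... | false | false rewrite ℕₚ.+-comm b 4 | ≡ᵇ-false-parity {H} {3 + b} odd-H (trans (isOdd-suc b) (cong not odd-b))
  = ≈₃-sym (⊕₃-identityʳ _)

∑<-gapOK : ∀ N H (F : ℕ → Ser3) → F 0 ≈₃ zero3 → H < N →
  ∑< N (λ b → onlyIf (gapOK H b) (F b)) ≈₃ F (H ∸ sameParityGap H) ⊕₃ F (H ∸ 3)
∑<-gapOK N H F F0≈0 H<N = begin
  ∑< N (λ b → onlyIf (gapOK H b) (F b))
    ≈⟨ ∑<-cong N (λ b _ → onlyIf-gapOK H b (F b)) ⟩
  ∑< N (λ b → onlyIf (H ≡ᵇ sameParityGap H + b) (F b) ⊕₃ onlyIf (H ≡ᵇ 3 + b) (F b))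
    ≈⟨ ∑<-⊕₃ N _ _ ⟩
  ∑< N (λ b → onlyIf (H ≡ᵇ sameParityGap H + b) (F b)) ⊕₃ ∑< N (λ b → onlyIf (H ≡ᵇ 3 + b) (F b))
    ≈⟨ ⊕₃-cong (∑<-offset N H (sameParityGap H) F F0≈0 H<N) (∑<-offset N H 3 F F0≈0 H<N) ⟩
  F (H ∸ sameParityGap H) ⊕₃ F (H ∸ 3) ∎
  where open ≈₃-Reasoning

B4rec : ℕ → ℕ → Ser3
B4rec zero          H = zero3
B4rec (suc zero)    H = if H ≡ᵇ 1 then mono3 1 0 1 else if H ≡ᵇ 2 then mono3 0 1 2 else zero3
B4rec (suc (suc n)) H = shift₃ ([odd] H) ([even] H) H
  (B4rec (suc n) (H ∸ sameParityGap H) ⊕₃ B4rec (suc n) (H ∸ 3))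

B4rec-vanish : ∀ n {H} → H ≤ 2 * n → B4rec (suc n) H ≈₃ zero3
B4rec-vanish zero    z≤n = ≈₃-refl
B4rec-vanish (suc n) {H} H≤ = shift₃-vanish ([odd] H) ([even] H) H
  (≈₃-trans (⊕₃-cong (B4rec-vanish n (bound (2≤sameParityGap H))) (B4rec-vanish n (bound (s≤s (s≤s z≤n)))))
            (⊕₃-identityˡ zero3))
  where
  bound : ∀ {k} → 2 ≤ k → H ∸ k ≤ 2 * n
  bound 2≤k = ℕₚ.∸-mono (subst (H ≤_) (ℕₚ.*-suc 2 n) H≤) 2≤k

B4-term : ℕ → ℕ → List ℕ → Ser3
B4-term n H λs = onlyIf (inB4 λs ∧ largestIs H λs ∧ (length λs ≡ᵇ n)) (mono3 (o λs) (e λs) (sum λs))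

B4-term-head : ∀ n H x l → B4-term (suc n) H (x ∷ l) ≈₃ onlyIf (x ≡ᵇ H) (B4-term (suc n) H (H ∷ l))
B4-term-head n H x l with x ℕ.≟ H
... | yes refl rewrite ≡ᵇ-refl x = ≈₃-refl
... | no x≢H rewrite ≡ᵇ-false x≢H | Boolₚ.∧-zeroʳ (inB4 (x ∷ l)) = ≈₃-refl

B4-term-step : ∀ n H b l → B4-term (2 + n) H (H ∷ b ∷ l)
  ≈₃ onlyIf (gapOK H b) (shift₃ ([odd] H) ([even] H) H (B4-term (suc n) b (b ∷ l)))
B4-term-step n zero    b l rewrite gapOK-zero b = ≈₃-refl
B4-term-step n (suc H) b l with gapOK (suc H) b
... | false rewrite Boolₚ.∧-zeroʳ (allPos (b ∷ l)) = ≈₃-refl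
... | true  rewrite ≡ᵇ-refl H | ≡ᵇ-refl b with inB4 (b ∷ l) ∧ (length l ≡ᵇ n)
...   | true  = ≈₃-sym (shift₃-mono3 ([odd] (suc H)) ([even] (suc H)) (suc H) (o (b ∷ l)) (e (b ∷ l)) (sum (b ∷ l)))
...   | false = ≈₃-sym (shift₃-zero3 ([odd] (suc H)) ([even] (suc H)) (suc H))

B4-term-one : ∀ H → B4-term 1 H (H ∷ []) ≈₃ B4rec 1 H
B4-term-one 0                   = ≈₃-refl
B4-term-one 1                   = ≈₃-refl
B4-term-one 2                   = ≈₃-refl
B4-term-one (suc (suc (suc H))) = ≈₃-refl

B4-headed : ℕ → ℕ → List ℕ → Ser3
B4-headed n H X = sumOver (listsOf n X) (λ l → B4-term (suc n) H (H ∷ l))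

B4-headed≈B4rec : ∀ n {H H₀} → H ≤ H₀ → B4-headed n H (upTo (suc H₀)) ≈₃ B4rec (suc n) H
B4-headed≈B4rec zero    {H} _ = ≈₃-trans (⊕₃-identityʳ (B4-term 1 H (H ∷ []))) (B4-term-one H)
B4-headed≈B4rec (suc n) {H} {H₀} H≤H₀ = begin
  sumOver (listsOf (suc n) X) (λ l → B4-term (2 + n) H (H ∷ l))
    ≈⟨ sumOver-listsOf-upTo n (suc H₀) _ ⟩
  ∑< (suc H₀) (λ b → sumOver (listsOf n X) (λ l → B4-term (2 + n) H (H ∷ b ∷ l)))
    ≈⟨ ∑<-cong (suc H₀) (λ b b≤H₀ → second-part b (ℕₚ.≤-pred b≤H₀)) ⟩
  ∑< (suc H₀) (λ b → onlyIf (gapOK H b) (shift₃ x y H (B4rec (suc n) b)))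
    ≈⟨ ∑<-gapOK (suc H₀) H (λ b → shift₃ x y H (B4rec (suc n) b)) (shift₃-vanish x y H (B4rec-vanish n z≤n)) (s≤s H≤H₀) ⟩
  shift₃ x y H (B4rec (suc n) (H ∸ sameParityGap H)) ⊕₃ shift₃ x y H (B4rec (suc n) (H ∸ 3))
    ≈⟨ shift₃-⊕₃ x y H _ _ ⟨
  B4rec (2 + n) H ∎
  where
  open ≈₃-Reasoning
  X = upTo (suc H₀)
  x = [odd] H
  y = [even] H
  second-part : ∀ b → b ≤ H₀ → sumOver (listsOf n X) (λ l → B4-term (2 + n) H (H ∷ b ∷ l))
                                 ≈₃ onlyIf (gapOK H b) (shift₃ x y H (B4rec (suc n) b))
  second-part b b≤H₀ = begin
    sumOver (listsOf n X) (λ l → B4-term (2 + n) H (H ∷ b ∷ l))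
      ≈⟨ sumOver-cong (listsOf n X) (B4-term-step n H b) ⟩
    sumOver (listsOf n X) (λ l → onlyIf (gapOK H b) (shift₃ x y H (B4-term (suc n) b (b ∷ l))))
      ≈⟨ sumOver-onlyIf (gapOK H b) (listsOf n X) _ ⟩
    onlyIf (gapOK H b) (sumOver (listsOf n X) (λ l → shift₃ x y H (B4-term (suc n) b (b ∷ l))))
      ≈⟨ onlyIf-cong (gapOK H b) (sumOver-shift₃ x y H (listsOf n X) _) ⟩
    onlyIf (gapOK H b) (shift₃ x y H (B4-headed n b X))
      ≈⟨ onlyIf-cong (gapOK H b) (shift₃-cong x y H (B4-headed≈B4rec n b≤H₀)) ⟩
    onlyIf (gapOK H b) (shift₃ x y H (B4rec (suc n) b)) ∎

B4≈B4rec : ∀ n H → B4 (suc n) H ≈₃ B4rec (suc n) H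
B4≈B4rec n H = begin
  sumOver (listsOf (suc n) X) (B4-term (suc n) H)
    ≈⟨ sumOver-listsOf-upTo n (suc H) _ ⟩
  ∑< (suc H) (λ x → sumOver (listsOf n X) (λ l → B4-term (suc n) H (x ∷ l)))
    ≈⟨ ∑<-cong (suc H) (λ x _ → ≈₃-trans (sumOver-cong (listsOf n X) (B4-term-head n H x))
                                         (sumOver-onlyIf (x ≡ᵇ H) (listsOf n X) _)) ⟩
  ∑< (suc H) (λ x → onlyIf (x ≡ᵇ H) (B4-headed n H X))
    ≈⟨ ∑<-single (suc H) H (λ _ → B4-headed n H X) ℕₚ.≤-refl ⟩
  B4-headed n H X
    ≈⟨ B4-headed≈B4rec n ℕₚ.≤-refl ⟩
  B4rec (suc n) H ∎
  where
  open ≈₃-Reasoning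
  X = upTo (suc H)

-- The closed forms

B4rec-parity : ∀ n H {p} → isOdd H ≡ p →
  B4rec (2 + n) H ≈₃ shift₃ (if p then 1 else 0) (if p then 0 else 1) H
                        (B4rec (suc n) (H ∸ (if p then 2 else 4)) ⊕₃ B4rec (suc n) (H ∸ 3))
B4rec-parity n H refl = ≈₃-refl

B4rec-odd-unfold : ∀ n t →
  B4rec (2 + n) (3 + 2 * t) ≈₃ shift₃ 1 0 (3 + 2 * t) (B4rec (suc n) (1 + 2 * t) ⊕₃ B4rec (suc n) (2 * t))
B4rec-odd-unfold n t = B4rec-parity n (3 + 2 * t) (isOdd-1+double t)

B4rec-even-unfold : ∀ n t →
  B4rec (2 + n) (4 + 2 * t) ≈₃ shift₃ 0 1 (4 + 2 * t) (B4rec (suc n) (2 * t) ⊕₃ B4rec (suc n) (1 + 2 * t))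
B4rec-even-unfold n t = B4rec-parity n (4 + 2 * t) (isOdd-double t)

binom₃ : ℕ → ℕ → Ser3
binom₃ n h = liftQ (qBinom n h)

-- For h > n the coefficient vanishes, so the x-exponent (a truncated subtraction) only
-- matters when h ≤ n.
shift₃-binom₃-align : ∀ {n h x X} y e → (h ≤ n → x ≡ X) →
  shift₃ x y e (binom₃ n h) ≈₃ shift₃ X y e (binom₃ n h)
shift₃-binom₃-align {n} {h} {x} {X} y e x≡X with h ℕ.≤? n
... | yes h≤n = shift₃-≡ {b = y} {c = e} (binom₃ n h) (x≡X h≤n) refl refl
... | no  h≰n = ≈₃-trans (shift₃-vanish x y e binom₃≈0) (≈₃-sym (shift₃-vanish X y e binom₃≈0))
  where binom₃≈0 = ≈₃-trans (liftQ-cong (qBinom-vanish (ℕₚ.≰⇒> h≰n))) liftQ-zeroS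

pascal₃ : ∀ n h x X y E {e₁ e₂} → (h ≤ n → x ≡ X) → e₁ ≡ E + (2 + 2 * h) → e₂ ≡ E →
  shift₃ x y e₁ (binom₃ n (suc h)) ⊕₃ shift₃ x y e₂ (binom₃ n h) ≈₃ shift₃ X y E (binom₃ (suc n) (suc h))
pascal₃ n h x X y E x≡X refl refl = begin
  shift₃ x y (E + c) (binom₃ n (suc h)) ⊕₃ shift₃ x y E (binom₃ n h)
    ≈⟨ ⊕₃-cong (shift₃-binom₃-align y (E + c) (x≡X ∘ ℕₚ.<⇒≤)) (shift₃-binom₃-align y E x≡X) ⟩
  shift₃ X y (E + c) (binom₃ n (suc h)) ⊕₃ shift₃ X y E (binom₃ n h)
    ≈⟨ ⊕₃-congʳ (shift₃ X y E (binom₃ n h)) raise ⟨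
  shift₃ X y E (shift₃ 0 0 c (binom₃ n (suc h))) ⊕₃ shift₃ X y E (binom₃ n h)
    ≈⟨ shift₃-⊕₃ X y E _ _ ⟨
  shift₃ X y E (shift₃ 0 0 c (binom₃ n (suc h)) ⊕₃ binom₃ n h)
    ≈⟨ shift₃-cong X y E (⊕₃-congʳ (binom₃ n h) (liftQ-shift c (qBinom n (suc h)))) ⟨
  shift₃ X y E (liftQ (shift c (qBinom n (suc h))) ⊕₃ binom₃ n h)
    ≈⟨ shift₃-cong X y E (liftQ-⊕ (shift c (qBinom n (suc h))) (qBinom n h)) ⟨
  shift₃ X y E (binom₃ (suc n) (suc h)) ∎
  where
  open ≈₃-Reasoning
  c = 2 + 2 * h
  raise : shift₃ X y E (shift₃ 0 0 c (binom₃ n (suc h))) ≈₃ shift₃ X y (E + c) (binom₃ n (suc h))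
  raise = ≈₃-trans (shift₃-shift₃ X y E 0 0 c (binom₃ n (suc h)))
                   (shift₃-≡ {c = E + c} (binom₃ n (suc h)) (ℕₚ.+-identityʳ X) (ℕₚ.+-identityʳ y) refl)

2*[m+1+n]≡2+2*[m+n] : ∀ m n → 2 * (m + suc n) ≡ 2 + 2 * (m + n)
2*[m+1+n]≡2+2*[m+n] m n = trans (cong (2 *_) (ℕₚ.+-suc m n)) (ℕₚ.*-suc 2 (m + n))

B4rec-odd : ∀ n h → B4rec (suc n) (1 + 2 * (n + h))
  ≈₃ shift₃ (suc n ∸ h) h (suc n * suc n + h * h + 2 * h) (binom₃ n h)
B4rec-even : ∀ n h → B4rec (suc n) (2 + 2 * (n + h))
  ≈₃ shift₃ (n ∸ h) (suc h) (suc n * suc n + h * h + 2 * h + 1) (binom₃ n h)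

B4rec-even-below : ∀ n h → B4rec (suc n) (2 * (n + suc h))
  ≈₃ shift₃ (n ∸ h) (suc h) (suc n * suc n + h * h + 2 * h + 1) (binom₃ n h)
B4rec-even-below n h = ≈₃-trans (≈₃-reflexive (cong (B4rec (suc n)) (2*[m+1+n]≡2+2*[m+n] n h))) (B4rec-even n h)

B4rec-odd zero zero = ≈₃-sym (≈₃-trans (shift₃-cong 1 0 1 liftQ-oneS) (shift₃-mono3 1 0 1 0 0 0))
B4rec-odd zero (suc h) = ≈₃-trans (≈₃-reflexive (cong (λ t → B4rec 1 (1 + t)) (ℕₚ.*-suc 2 h)))
                                  (≈₃-sym (shift₃-vanish (1 ∸ suc h) (suc h) (1 * 1 + suc h * suc h + 2 * suc h) liftQ-zeroS))
B4rec-odd (suc n) zero = begin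
  B4rec (2 + n) (1 + 2 * (suc n + 0))
    ≡⟨ cong (λ t → B4rec (2 + n) (1 + t)) (ℕₚ.*-suc 2 (n + 0)) ⟩
  B4rec (2 + n) (3 + 2 * (n + 0))
    ≈⟨ B4rec-odd-unfold n (n + 0) ⟩
  shift₃ 1 0 H (B4rec (suc n) (1 + 2 * (n + 0)) ⊕₃ B4rec (suc n) (2 * (n + 0)))
    ≈⟨ shift₃-cong 1 0 H (⊕₃-cong (B4rec-odd n 0) (B4rec-vanish n (ℕₚ.≤-reflexive (cong (2 *_) (ℕₚ.+-identityʳ n))))) ⟩
  shift₃ 1 0 H (shift₃ (suc n) 0 E (binom₃ n 0) ⊕₃ zero3)
    ≈⟨ shift₃-cong 1 0 H (⊕₃-identityʳ _) ⟩
  shift₃ 1 0 H (shift₃ (suc n) 0 E (binom₃ n 0))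
    ≈⟨ shift₃-shift₃ 1 0 H (suc n) 0 E (binom₃ n 0) ⟩
  shift₃ (2 + n) 0 (H + E) (binom₃ n 0)
    ≈⟨ shift₃-≡ {a = 2 + n} {b = 0} (binom₃ n 0) refl refl (exponent n) ⟩
  shift₃ (2 + n) 0 (suc (suc n) * suc (suc n) + 0 * 0 + 2 * 0) (binom₃ (suc n) 0) ∎
  where
  open ≈₃-Reasoning
  H = 3 + 2 * (n + 0)
  E = suc n * suc n + 0 * 0 + 2 * 0
  exponent : ∀ n → 3 + 2 * (n + 0) + (suc n * suc n + 0 * 0 + 2 * 0) ≡ suc (suc n) * suc (suc n) + 0 * 0 + 2 * 0
  exponent = ℕ-Solver.solve-∀
B4rec-odd (suc n) (suc h) = begin
  B4rec (2 + n) (1 + 2 * (suc n + suc h))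
    ≡⟨ cong (λ t → B4rec (2 + n) (1 + t)) (ℕₚ.*-suc 2 (n + suc h)) ⟩
  B4rec (2 + n) (3 + 2 * (n + suc h))
    ≈⟨ B4rec-odd-unfold n (n + suc h) ⟩
  shift₃ 1 0 H (B4rec (suc n) (1 + 2 * (n + suc h)) ⊕₃ B4rec (suc n) (2 * (n + suc h)))
    ≈⟨ shift₃-cong 1 0 H (⊕₃-cong (B4rec-odd n (suc h)) (B4rec-even-below n h)) ⟩
  shift₃ 1 0 H (shift₃ (n ∸ h) (suc h) E₁ (binom₃ n (suc h)) ⊕₃ shift₃ (n ∸ h) (suc h) E₀ (binom₃ n h))
    ≈⟨ shift₃-⊕₃-shift₃ 1 0 H (n ∸ h) (suc h) E₁ (n ∸ h) (suc h) E₀ (binom₃ n (suc h)) (binom₃ n h) ⟩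
  shift₃ (1 + (n ∸ h)) (suc h) (H + E₁) (binom₃ n (suc h)) ⊕₃ shift₃ (1 + (n ∸ h)) (suc h) (H + E₀) (binom₃ n h)
    ≈⟨ pascal₃ n h (1 + (n ∸ h)) (suc n ∸ h) (suc h) _ (λ h≤n → sym (ℕₚ.+-∸-assoc 1 h≤n)) (upper n h) (lower n h) ⟩
  shift₃ (suc n ∸ h) (suc h) (suc (suc n) * suc (suc n) + suc h * suc h + 2 * suc h) (binom₃ (suc n) (suc h)) ∎
  where
  open ≈₃-Reasoning
  H  = 3 + 2 * (n + suc h)
  E₁ = suc n * suc n + suc h * suc h + 2 * suc h
  E₀ = suc n * suc n + h * h + 2 * h + 1
  upper : ∀ n h → 3 + 2 * (n + suc h) + (suc n * suc n + suc h * suc h + 2 * suc h)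
                  ≡ suc (suc n) * suc (suc n) + suc h * suc h + 2 * suc h + (2 + 2 * h)
  upper = ℕ-Solver.solve-∀
  lower : ∀ n h → 3 + 2 * (n + suc h) + (suc n * suc n + h * h + 2 * h + 1)
                  ≡ suc (suc n) * suc (suc n) + suc h * suc h + 2 * suc h
  lower = ℕ-Solver.solve-∀

B4rec-even zero zero = ≈₃-sym (≈₃-trans (shift₃-cong 0 1 2 liftQ-oneS) (shift₃-mono3 0 1 2 0 0 0))
B4rec-even zero (suc h) = ≈₃-sym (shift₃-vanish (0 ∸ suc h) (2 + h) (1 * 1 + suc h * suc h + 2 * suc h + 1) liftQ-zeroS)
B4rec-even (suc n) zero = begin
  B4rec (2 + n) (2 + 2 * (suc n + 0))
    ≡⟨ cong (λ t → B4rec (2 + n) (2 + t)) (ℕₚ.*-suc 2 (n + 0)) ⟩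
  B4rec (2 + n) (4 + 2 * (n + 0))
    ≈⟨ B4rec-even-unfold n (n + 0) ⟩
  shift₃ 0 1 H (B4rec (suc n) (2 * (n + 0)) ⊕₃ B4rec (suc n) (1 + 2 * (n + 0)))
    ≈⟨ shift₃-cong 0 1 H (⊕₃-cong (B4rec-vanish n (ℕₚ.≤-reflexive (cong (2 *_) (ℕₚ.+-identityʳ n)))) (B4rec-odd n 0)) ⟩
  shift₃ 0 1 H (zero3 ⊕₃ shift₃ (suc n) 0 E (binom₃ n 0))
    ≈⟨ shift₃-cong 0 1 H (⊕₃-identityˡ _) ⟩
  shift₃ 0 1 H (shift₃ (suc n) 0 E (binom₃ n 0))
    ≈⟨ shift₃-shift₃ 0 1 H (suc n) 0 E (binom₃ n 0) ⟩
  shift₃ (suc n) 1 (H + E) (binom₃ n 0)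
    ≈⟨ shift₃-≡ {a = suc n} {b = 1} (binom₃ n 0) refl refl (exponent n) ⟩
  shift₃ (suc n) 1 (suc (suc n) * suc (suc n) + 0 * 0 + 2 * 0 + 1) (binom₃ (suc n) 0) ∎
  where
  open ≈₃-Reasoning
  H = 4 + 2 * (n + 0)
  E = suc n * suc n + 0 * 0 + 2 * 0
  exponent : ∀ n → 4 + 2 * (n + 0) + (suc n * suc n + 0 * 0 + 2 * 0) ≡ suc (suc n) * suc (suc n) + 0 * 0 + 2 * 0 + 1
  exponent = ℕ-Solver.solve-∀
B4rec-even (suc n) (suc h) = begin
  B4rec (2 + n) (2 + 2 * (suc n + suc h))
    ≡⟨ cong (λ t → B4rec (2 + n) (2 + t)) (ℕₚ.*-suc 2 (n + suc h)) ⟩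
  B4rec (2 + n) (4 + 2 * (n + suc h))
    ≈⟨ B4rec-even-unfold n (n + suc h) ⟩
  shift₃ 0 1 H (B4rec (suc n) (2 * (n + suc h)) ⊕₃ B4rec (suc n) (1 + 2 * (n + suc h)))
    ≈⟨ shift₃-cong 0 1 H (⊕₃-cong (B4rec-even-below n h) (B4rec-odd n (suc h))) ⟩
  shift₃ 0 1 H (shift₃ (n ∸ h) (suc h) E₀ (binom₃ n h) ⊕₃ shift₃ (n ∸ h) (suc h) E₁ (binom₃ n (suc h)))
    ≈⟨ shift₃-⊕₃-shift₃ 0 1 H (n ∸ h) (suc h) E₀ (n ∸ h) (suc h) E₁ (binom₃ n h) (binom₃ n (suc h)) ⟩
  shift₃ (n ∸ h) (2 + h) (H + E₀) (binom₃ n h) ⊕₃ shift₃ (n ∸ h) (2 + h) (H + E₁) (binom₃ n (suc h))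
    ≈⟨ ⊕₃-comm (shift₃ (n ∸ h) (2 + h) (H + E₀) (binom₃ n h)) (shift₃ (n ∸ h) (2 + h) (H + E₁) (binom₃ n (suc h))) ⟩
  shift₃ (n ∸ h) (2 + h) (H + E₁) (binom₃ n (suc h)) ⊕₃ shift₃ (n ∸ h) (2 + h) (H + E₀) (binom₃ n h)
    ≈⟨ pascal₃ n h (n ∸ h) (n ∸ h) (2 + h) _ (λ _ → refl) (upper n h) (lower n h) ⟩
  shift₃ (n ∸ h) (2 + h) (suc (suc n) * suc (suc n) + suc h * suc h + 2 * suc h + 1) (binom₃ (suc n) (suc h)) ∎
  where
  open ≈₃-Reasoning
  H  = 4 + 2 * (n + suc h)
  E₁ = suc n * suc n + suc h * suc h + 2 * suc h
  E₀ = suc n * suc n + h * h + 2 * h + 1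
  upper : ∀ n h → 4 + 2 * (n + suc h) + (suc n * suc n + suc h * suc h + 2 * suc h)
                  ≡ suc (suc n) * suc (suc n) + suc h * suc h + 2 * suc h + 1 + (2 + 2 * h)
  upper = ℕ-Solver.solve-∀
  lower : ∀ n h → 4 + 2 * (n + suc h) + (suc n * suc n + h * h + 2 * h + 1)
                  ≡ suc (suc n) * suc (suc n) + suc h * suc h + 2 * suc h + 1
  lower = ℕ-Solver.solve-∀

shift₃-binom₃≈mono3-⊛₃ : ∀ a b c n h → shift₃ a b c (binom₃ n h) ≈₃ mono3 a b c ⊛₃ liftQ (gaussian 2 n h)
shift₃-binom₃≈mono3-⊛₃ a b c n h = ≈₃-sym (≈₃-trans (mono3-⊛₃ a b c (liftQ (gaussian 2 n h)))
                                                    (shift₃-cong a b c (liftQ-cong (gaussian≗qBinom n h))))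

2*[1+m]+2*n≡2+2*[m+n] : ∀ m n → 2 * suc m + 2 * n ≡ 2 + 2 * (m + n)
2*[1+m]+2*n≡2+2*[m+n] = ℕ-Solver.solve-∀

B4-odd : ∀ n h → B4 (suc n) (2 * suc n + 2 * h ∸ 1)
  ≈₃ mono3 (suc n ∸ h) h (suc n * suc n + h * h + 2 * h) ⊛₃ liftQ (gaussian 2 n h)
B4-odd n h = begin
  B4 (suc n) (2 * suc n + 2 * h ∸ 1)  ≡⟨ cong (λ H → B4 (suc n) (H ∸ 1)) (2*[1+m]+2*n≡2+2*[m+n] n h) ⟩
  B4 (suc n) (1 + 2 * (n + h))        ≈⟨ B4≈B4rec n (1 + 2 * (n + h)) ⟩
  B4rec (suc n) (1 + 2 * (n + h))     ≈⟨ B4rec-odd n h ⟩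
  shift₃ (suc n ∸ h) h E (binom₃ n h) ≈⟨ shift₃-binom₃≈mono3-⊛₃ (suc n ∸ h) h E n h ⟩
  mono3 (suc n ∸ h) h E ⊛₃ liftQ (gaussian 2 n h) ∎
  where
  open ≈₃-Reasoning
  E = suc n * suc n + h * h + 2 * h

B4-even : ∀ n h → B4 (suc n) (2 * suc n + 2 * h)
  ≈₃ mono3 (suc n ∸ h ∸ 1) (h + 1) (suc n * suc n + h * h + 2 * h + 1) ⊛₃ liftQ (gaussian 2 n h)
B4-even n h = begin
  B4 (suc n) (2 * suc n + 2 * h)            ≡⟨ cong (B4 (suc n)) (2*[1+m]+2*n≡2+2*[m+n] n h) ⟩
  B4 (suc n) (2 + 2 * (n + h))              ≈⟨ B4≈B4rec n (2 + 2 * (n + h)) ⟩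
  B4rec (suc n) (2 + 2 * (n + h))           ≈⟨ B4rec-even n h ⟩
  shift₃ (n ∸ h) (suc h) E (binom₃ n h)     ≈⟨ shift₃-binom₃≈mono3-⊛₃ (n ∸ h) (suc h) E n h ⟩
  mono3 (n ∸ h) (suc h) E ⊛₃ liftQ (gaussian 2 n h)
    ≡⟨ cong₂ (λ a b → mono3 a b E ⊛₃ liftQ (gaussian 2 n h)) x-exponent (ℕₚ.+-comm 1 h) ⟩
  mono3 (suc n ∸ h ∸ 1) (h + 1) E ⊛₃ liftQ (gaussian 2 n h) ∎
  where
  open ≈₃-Reasoning
  E = suc n * suc n + h * h + 2 * h + 1
  x-exponent : n ∸ h ≡ suc n ∸ h ∸ 1
  x-exponent = trans (cong (suc n ∸_) (ℕₚ.+-comm 1 h)) (sym (ℕₚ.∸-+-assoc (suc n) h 1))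

theorem3p3 : (n h : ℕ) → 1 ≤ n → 1 ≤ h →
    ((i j m : ℕ) → B4 n (2 * n + 2 * h ∸ 1) i j m
        ≡ (mono3 (n ∸ h) h (n * n + h * h + 2 * h) ⊛₃ liftQ (gaussian 2 (n ∸ 1) h)) i j m)
    × ((i j m : ℕ) → B4 n (2 * n + 2 * h) i j m
        ≡ (mono3 (n ∸ h ∸ 1) (h + 1) (n * n + h * h + 2 * h + 1) ⊛₃ liftQ (gaussian 2 (n ∸ 1) h)) i j m)
theorem3p3 (suc n) h (s≤s z≤n) _ = B4-odd n h , B4-even n h
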